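{- Let $m,n$ be coprime positive integers. For any $n$-element set $X\subset[m]$, the expected maxloads of strided hashing $\bigcirc\mathbb{Z}_m\mathsf{H}$ and blocked hashing $\square\mathbb{Z}_m\mathsf{H}$ on $X$ differ by at most a factor of $2$ (each is at most twice the other).
   Context: $[N]=\{0,\dots,N-1\}$; for positive integer $N$, $\mathfrak{m}_N(x)$ is the unique element of $(x+N\mathbb{Z})\cap[0,N)$. In both schemes $a$ is chosen uniformly from $\{1,\dots,m-1\}$ and there are $n$ bins. Blocked hashing $\square\mathbb{Z}_m\mathsf{H}$ places $x\in[m]$ in bin $\lfloor\mathfrak{m}_m(ax)/(m/n)\rfloor$; strided hashing $\bigcirc\mathbb{Z}_m\mathsf{H}$ places $x$ in bin $\mathfrak{m}_n(\mathfrak{m}_m(ax))$. The maxload on $X$ is the number of elements of $X$ in the fullest bin. -}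

module Defs where

open import Data.Nat using (ℕ; suc; _+_; _*_; _∸_; _⊔_; NonZero)
open import Data.Nat.DivMod using (_/_; _%_)
open import Data.Nat.Properties using (_≟_)
open import Data.List using (List; map; foldr; upTo; length; filter)
open import Data.Nat.ListAction using (sum)

stridedBin : (m n : ℕ) .{{_ : NonZero m}} .{{_ : NonZero n}} → ℕ → ℕ → ℕ
stridedBin m n a x = ((a * x) % m) % n

-- Blocked hashing □ℤ_mH with multiplier a: x ↦ ⌊ 𝔪_m(a x) / (m/n) ⌋ = ⌊ 𝔪_m(a x) · n / m ⌋.
blockedBin : (m n : ℕ) .{{_ : NonZero m}} → ℕ → ℕ → ℕ
blockedBin m n a x = (((a * x) % m) * n) / m

load : (ℕ → ℕ) → List ℕ → ℕ → ℕ
load h X b = length (filter (λ x → h x ≟ b) X)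

maxload : (n : ℕ) → (ℕ → ℕ) → List ℕ → ℕ
maxload n h X = foldr _⊔_ 0 (map (load h X) (upTo n))

multipliers : ℕ → List ℕ
multipliers m = map suc (upTo (m ∸ 1))

-- (m-1) · E_a[maxload] for strided / blocked hashing
totalStrided : (m n : ℕ) .{{_ : NonZero m}} .{{_ : NonZero n}} → List ℕ → ℕ
totalStrided m n X = sum (map (λ a → maxload n (stridedBin m n a) X) (multipliers m))

totalBlocked : (m n : ℕ) .{{_ : NonZero m}} → List ℕ → ℕ
totalBlocked m n X = sum (map (λ a → maxload n (blockedBin m n a) X) (multipliers m))

module Submission where

-- For a multiplier a put a′ = a·n mod m.  Splitting 𝔪_m(a x)·n = 𝔪_m(a′ x) + B·m, where B is the
-- blocked bin of x under a, gives 𝔪_m(a′ x) ≡ −B·m (mod n); as m is invertible mod n, two keys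
-- share a blocked bin under a iff they share a strided bin under a′.  So both hash functions cut
-- X into the same parts and have the same maxload, and since a ↦ a′ permutes {1,…,m−1} the two
-- expected maxloads are equal, for every list X (the size and distinctness hypotheses are unused).

open import Defs
open import Data.Nat using (ℕ; suc; z<s; >-nonZero⁻¹; _*_; _+_; _⊔_; _<_; _≤_; z≤n; s≤s; NonZero; ∣_-_∣; _∸_)
open import Data.Nat.Properties
open import Data.Nat.DivMod using (_%_; _/_; m≡m%n+[m/n]*n; m%n<n; m<n⇒m%n≡m; m%n%n≡m%n; %-remove-+ʳ; m<n*o⇒m/o<n)
open import Data.Nat.Divisibility using (_∣_; divides; ∣m⇒∣m*n; n∣m*n)
open import Data.Nat.Coprimality using (Coprime; coprime-divisor)
import Data.Nat.Coprimality as Coprime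
open import Data.Nat.ListAction using (sum)
open import Data.Nat.ListAction.Properties using (sum-↭)
open import Data.List using (List; []; _∷_; _++_; length; map; foldr)
open import Data.List.Properties using (map-cong; map-∘; length-map; filter-≐; filter-none)
open import Data.List.Relation.Unary.All using (All; []; _∷_)
import Data.List.Relation.Unary.All as All
import Data.List.Relation.Unary.All.Properties as All
open import Data.List.Relation.Unary.Any using (Any; here; there; any?; satisfied)
open import Data.List.Relation.Unary.Unique.Propositional using (Unique)
open import Data.List.Relation.Unary.AllPairs using ([]; _∷_)
import Data.List.Relation.Unary.Unique.Propositional.Properties as Unique
open import Data.List.Membership.Propositional using (_∈_)
open import Data.List.Membership.Propositional.Properties using (∈-∃++; ∈-map⁺; ∈-map⁻; ∈-upTo⁺; ∈-upTo⁻)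
open import Data.List.Relation.Binary.Subset.Propositional using (_⊆_)
open import Data.List.Relation.Binary.Permutation.Propositional using (_↭_; ↭-refl; ↭-sym; ↭-trans; prep)
import Data.List.Relation.Binary.Permutation.Propositional.Properties as ↭
open import Data.Product using (_×_; _,_; proj₁; proj₂)
open import Data.Sum using (inj₁; inj₂)
open import Function using (_∘_; case_of_)
open import Function.Bundles using (_⇔_; mk⇔; Equivalence)
import Function.Properties.Equivalence as ⇔
open import Algebra.Properties.CommutativeSemigroup *-commutativeSemigroup using (xy∙z≈xz∙y)
open import Relation.Nullary using (yes; no; ¬_; contradiction)
open import Relation.Binary.PropositionalEquality

infix 4 _≡_mod_

_≡_mod_ : ℕ → ℕ → (d : ℕ) .{{_ : NonZero d}} → Set
x ≡ y mod d = x % d ≡ y % d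

∣m+k-n+k∣≡∣m-n∣ : ∀ m n k → ∣ m + k - n + k ∣ ≡ ∣ m - n ∣
∣m+k-n+k∣≡∣m-n∣ m n k = trans (cong₂ ∣_-_∣ (+-comm m k) (+-comm n k)) (∣m+n-m+o∣≡∣n-o∣ k m n)

module _ {d : ℕ} .{{_ : NonZero d}} where

  ≡-mod⇒∣∣-∣ : ∀ {x y} → x ≡ y mod d → d ∣ ∣ x - y ∣
  ≡-mod⇒∣∣-∣ {x} {y} eq = divides ∣ x / d - y / d ∣ (begin
    ∣ x - y ∣                                     ≡⟨ cong₂ ∣_-_∣ (m≡m%n+[m/n]*n x d) (m≡m%n+[m/n]*n y d) ⟩
    ∣ x % d + x / d * d - y % d + y / d * d ∣     ≡⟨ cong (λ r → ∣ r + x / d * d - y % d + y / d * d ∣) eq ⟩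
    ∣ y % d + x / d * d - y % d + y / d * d ∣     ≡⟨ ∣m+n-m+o∣≡∣n-o∣ (y % d) _ _ ⟩
    ∣ x / d * d - y / d * d ∣                     ≡⟨ *-distribʳ-∣-∣ d (x / d) (y / d) ⟨
    ∣ x / d - y / d ∣ * d                         ∎)
    where open ≡-Reasoning

  ≤∧∣∣-∣⇒≡-mod : ∀ {x y} → x ≤ y → d ∣ ∣ x - y ∣ → x ≡ y mod d
  ≤∧∣∣-∣⇒≡-mod {x} {y} x≤y d∣ = begin
    x % d                 ≡⟨ %-remove-+ʳ x (subst (d ∣_) (m≤n⇒∣m-n∣≡n∸m x≤y) d∣) ⟨
    (x + (y ∸ x)) % d     ≡⟨ cong (_% d) (m+[n∸m]≡n x≤y) ⟩
    y % d                 ∎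
    where open ≡-Reasoning

  ∣∣-∣⇒≡-mod : ∀ {x y} → d ∣ ∣ x - y ∣ → x ≡ y mod d
  ∣∣-∣⇒≡-mod {x} {y} d∣ with ≤-total x y
  ... | inj₁ x≤y = ≤∧∣∣-∣⇒≡-mod x≤y d∣
  ... | inj₂ y≤x = sym (≤∧∣∣-∣⇒≡-mod y≤x (subst (d ∣_) (∣-∣-comm x y) d∣))

  ∣⇒≡0-mod : ∀ {x} → d ∣ x → x ≡ 0 mod d
  ∣⇒≡0-mod {x} d∣x = ∣∣-∣⇒≡-mod (subst (d ∣_) (sym (∣-∣-identityʳ x)) d∣x)

  %-≡-mod : ∀ x → x % d ≡ x mod d
  %-≡-mod x = m%n%n≡m%n x d

  ≡-mod⇒≡ : ∀ {x y} → x < d → y < d → x ≡ y mod d → x ≡ y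
  ≡-mod⇒≡ {x} {y} x<d y<d eq = begin
    x       ≡⟨ m<n⇒m%n≡m x<d ⟨
    x % d   ≡⟨ eq ⟩
    y % d   ≡⟨ m<n⇒m%n≡m y<d ⟩
    y       ∎
    where open ≡-Reasoning

  +-congʳ-mod : ∀ {x y} k → x ≡ y mod d → x + k ≡ y + k mod d
  +-congʳ-mod {x} {y} k eq =
    ∣∣-∣⇒≡-mod (subst (d ∣_) (sym (∣m+k-n+k∣≡∣m-n∣ x y k)) (≡-mod⇒∣∣-∣ eq))

  *-congʳ-mod : ∀ {x y} k → x ≡ y mod d → x * k ≡ y * k mod d
  *-congʳ-mod {x} {y} k eq =
    ∣∣-∣⇒≡-mod (subst (d ∣_) (*-distribʳ-∣-∣ k x y) (∣m⇒∣m*n k (≡-mod⇒∣∣-∣ eq)))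

  +-cancelʳ-mod : ∀ {x y} k → x + k ≡ y + k mod d → x ≡ y mod d
  +-cancelʳ-mod {x} {y} k eq =
    ∣∣-∣⇒≡-mod (subst (d ∣_) (∣m+k-n+k∣≡∣m-n∣ x y k) (≡-mod⇒∣∣-∣ eq))

  *-cancelʳ-mod : ∀ {c x y} → Coprime d c → x * c ≡ y * c mod d → x ≡ y mod d
  *-cancelʳ-mod {c} {x} {y} d⊥c eq = ∣∣-∣⇒≡-mod (coprime-divisor d⊥c
    (subst (d ∣_) (trans (sym (*-distribʳ-∣-∣ c x y)) (*-comm ∣ x - y ∣ c)) (≡-mod⇒∣∣-∣ eq)))

  complement-mod : ∀ {u p v q} → u + p ≡ 0 mod d → v + q ≡ 0 mod d → u ≡ v mod d ⇔ p ≡ q mod d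
  complement-mod {u} {p} {v} {q} u+p≡0 v+q≡0 = mk⇔
    (transfer u+p≡0 v+q≡0)
    (transfer (swap u p u+p≡0) (swap v q v+q≡0))
    where
    swap : ∀ a b → a + b ≡ 0 mod d → b + a ≡ 0 mod d
    swap a b = subst (λ t → t % d ≡ 0 % d) (+-comm a b)

    transfer : ∀ {a b e f} → a + b ≡ 0 mod d → e + f ≡ 0 mod d → a ≡ e mod d → b ≡ f mod d
    transfer {a} {b} {e} {f} a+b≡0 e+f≡0 a≡e = +-cancelʳ-mod e (begin
      (b + e) % d   ≡⟨ cong (_% d) (+-comm b e) ⟩
      (e + b) % d   ≡⟨ +-congʳ-mod b a≡e ⟨
      (a + b) % d   ≡⟨ a+b≡0 ⟩
      0 % d         ≡⟨ e+f≡0 ⟨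
      (e + f) % d   ≡⟨ cong (_% d) (+-comm e f) ⟩
      (f + e) % d   ∎)
      where open ≡-Reasoning

≤-foldr-⊔ : ∀ {x xs} → x ∈ xs → x ≤ foldr _⊔_ 0 xs
≤-foldr-⊔ {xs = y ∷ ys} (here refl) = m≤m⊔n y _
≤-foldr-⊔ {xs = y ∷ ys} (there x∈ys) = ≤-trans (≤-foldr-⊔ x∈ys) (m≤n⊔m y _)

foldr-⊔-≤ : ∀ {k xs} → All (_≤ k) xs → foldr _⊔_ 0 xs ≤ k
foldr-⊔-≤ []             = z≤n
foldr-⊔-≤ (x≤k ∷ xs≤k)   = ⊔-lub x≤k (foldr-⊔-≤ xs≤k)

SameKernel : (ℕ → ℕ) → (ℕ → ℕ) → Set
SameKernel h h′ = ∀ x z → h x ≡ h z ⇔ h′ x ≡ h′ z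

module _ (h : ℕ → ℕ) (X : List ℕ) where

  load≤maxload : ∀ {n b} → b < n → load h X b ≤ maxload n h X
  load≤maxload b<n = ≤-foldr-⊔ (∈-map⁺ (load h X) (∈-upTo⁺ b<n))

  maxload≤ : ∀ {n k} → (∀ {b} → b < n → load h X b ≤ k) → maxload n h X ≤ k
  maxload≤ load≤k = foldr-⊔-≤ (All.map⁺ (All.tabulate (load≤k ∘ ∈-upTo⁻)))

  load-cong : ∀ {h′ b c} → (∀ y → h y ≡ b ⇔ h′ y ≡ c) → load h X b ≡ load h′ X c
  load-cong {h′} {b} {c} eq = cong length
    (filter-≐ (λ y → h y ≟ b) (λ y → h′ y ≟ c) (Equivalence.to (eq _) , Equivalence.from (eq _)) X)

  load-miss : ∀ {b} → ¬ Any (λ x → h x ≡ b) X → load h X b ≡ 0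
  load-miss miss = cong length (filter-none _ (All.¬Any⇒All¬ X miss))

maxload-mono : ∀ {n h h′} → SameKernel h h′ → (∀ x → h′ x < n) → ∀ X → maxload n h X ≤ maxload n h′ X
maxload-mono {n} {h} {h′} ker h′<n X = maxload≤ h X {n} λ {b} _ → load≤ b
  where
  load≤ : ∀ b → load h X b ≤ maxload n h′ X
  load≤ b with any? (λ x → h x ≟ b) X
  ... | no miss = subst (_≤ maxload n h′ X) (sym (load-miss h X miss)) z≤n
  ... | yes hit with satisfied hit
  ...   | x , refl = begin
    load h X (h x)     ≡⟨ load-cong h X (λ y → ker y x) ⟩
    load h′ X (h′ x)   ≤⟨ load≤maxload h′ X (h′<n x) ⟩
    maxload n h′ X     ∎
    where open ≤-Reasoning

maxload-cong : ∀ {n h h′} → SameKernel h h′ → (∀ x → h x < n) → (∀ x → h′ x < n) →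
               ∀ X → maxload n h X ≡ maxload n h′ X
maxload-cong ker h<n h′<n X = ≤-antisym
  (maxload-mono ker h′<n X) (maxload-mono (λ x z → ⇔.sym (ker x z)) h<n X)

module _ {a b} {A : Set a} {B : Set b} where

  Unique-map⁺-injectiveOn : ∀ {f : A → B} {xs} → (∀ {x y} → x ∈ xs → y ∈ xs → f x ≡ f y → x ≡ y) →
                            Unique xs → Unique (map f xs)
  Unique-map⁺-injectiveOn {xs = []}     _   []            = []
  Unique-map⁺-injectiveOn {xs = x ∷ xs} inj (x∉xs ∷ xs!) =
    All.map⁺ (All.tabulate λ y∈xs fx≡fy → All.lookup x∉xs y∈xs (inj (here refl) (there y∈xs) fx≡fy))
    ∷ Unique-map⁺-injectiveOn (λ x∈xs y∈xs → inj (there x∈xs) (there y∈xs)) xs!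

module _ {a} {A : Set a} where

  Unique∧⊆∧length≡⇒↭ : ∀ {xs ys : List A} → Unique xs → xs ⊆ ys → length xs ≡ length ys → xs ↭ ys
  Unique∧⊆∧length≡⇒↭ {[]}     {[]}    _ _ _ = ↭-refl
  Unique∧⊆∧length≡⇒↭ {x ∷ xs} (x∉xs ∷ xs!) xs⊆ys len with ∈-∃++ (xs⊆ys (here refl))
  ... | ys₁ , ys₂ , refl =
    ↭-trans (prep x (Unique∧⊆∧length≡⇒↭ xs! xs⊆ys₁++ys₂ (suc-injective (trans len (↭.↭-length x-first)))))
            (↭-sym x-first)
    where
    x-first : ys₁ ++ x ∷ ys₂ ↭ x ∷ ys₁ ++ ys₂
    x-first = ↭.shift x ys₁ ys₂

    xs⊆ys₁++ys₂ : xs ⊆ ys₁ ++ ys₂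
    xs⊆ys₁++ys₂ z∈xs with ↭.∈-resp-↭ x-first (xs⊆ys (there z∈xs))
    ... | here refl  = contradiction refl (All.lookup x∉xs z∈xs)
    ... | there z∈ys = z∈ys

∈-multipliers⁺ : ∀ {m a} → 0 < a → a < m → a ∈ multipliers m
∈-multipliers⁺ {suc m} {suc a} _ (s≤s a<m) = ∈-map⁺ suc (∈-upTo⁺ a<m)

∈-multipliers⁻ : ∀ {m a} → a ∈ multipliers m → 0 < a × a < m
∈-multipliers⁻ {suc m} a∈ with ∈-map⁻ suc a∈
... | i , i∈ , refl = z<s , s≤s (∈-upTo⁻ i∈)

Unique-multipliers : ∀ m → Unique (multipliers m)
Unique-multipliers m = Unique.map⁺ suc-injective (Unique.upTo⁺ (m ∸ 1))

dual : (m n : ℕ) .{{_ : NonZero m}} → ℕ → ℕ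
dual m n a = (a * n) % m

module _ (m n : ℕ) .{{_ : NonZero m}} .{{_ : NonZero n}} where

  blockedBin<n : ∀ a x → blockedBin m n a x < n
  blockedBin<n a x = m<n*o⇒m/o<n (subst (((a * x) % m) * n <_) (*-comm m n)
    (*-monoˡ-< n (m%n<n (a * x) m)))

  [ax%m]*n≡[dual*x]%m+blocked*m : ∀ a x →
    ((a * x) % m) * n ≡ (dual m n a * x) % m + blockedBin m n a x * m
  [ax%m]*n≡[dual*x]%m+blocked*m a x = begin
    r                                          ≡⟨ m≡m%n+[m/n]*n r m ⟩
    r % m + blockedBin m n a x * m              ≡⟨ cong (_+ blockedBin m n a x * m) r%m≡[dual*x]%m ⟩
    (dual m n a * x) % m + blockedBin m n a x * m ∎
    where
    open ≡-Reasoning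
    r : ℕ
    r = ((a * x) % m) * n
    r%m≡[dual*x]%m : r ≡ dual m n a * x mod m
    r%m≡[dual*x]%m = begin
      r % m                  ≡⟨ *-congʳ-mod n (%-≡-mod {m} (a * x)) ⟩
      (a * x * n) % m        ≡⟨ cong (_% m) (xy∙z≈xz∙y a x n) ⟩
      (a * n * x) % m        ≡⟨ *-congʳ-mod x (%-≡-mod {m} (a * n)) ⟨
      (dual m n a * x) % m   ∎

  [dual*x]%m+blocked*m≡0 : ∀ a x → (dual m n a * x) % m + blockedBin m n a x * m ≡ 0 mod n
  [dual*x]%m+blocked*m≡0 a x =
    ∣⇒≡0-mod (subst (n ∣_) ([ax%m]*n≡[dual*x]%m+blocked*m a x) (n∣m*n ((a * x) % m)))

  blocked-strided-kernel : Coprime m n → ∀ a x z →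
    blockedBin m n a x ≡ blockedBin m n a z ⇔ stridedBin m n (dual m n a) x ≡ stridedBin m n (dual m n a) z
  blocked-strided-kernel m⊥n a x z = ⇔.trans
    (mk⇔ (cong (λ b → (b * m) % n))
         (≡-mod⇒≡ (blockedBin<n a x) (blockedBin<n a z) ∘ *-cancelʳ-mod (Coprime.sym m⊥n)))
    (⇔.sym (complement-mod ([dual*x]%m+blocked*m≡0 a x) ([dual*x]%m+blocked*m≡0 a z)))

module _ {m n : ℕ} .{{_ : NonZero m}} (m⊥n : Coprime m n) where

  dual-injectiveOn : ∀ {a b} → a < m → b < m → dual m n a ≡ dual m n b → a ≡ b
  dual-injectiveOn a<m b<m eq = ≡-mod⇒≡ a<m b<m (*-cancelʳ-mod m⊥n eq)

  dual∈multipliers : ∀ {a} → a ∈ multipliers m → dual m n a ∈ multipliers m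
  dual∈multipliers {a} a∈ = ∈-multipliers⁺ (n≢0⇒n>0 dual≢0) (m%n<n (a * n) m)
    where
    0<m : 0 < m
    0<m = >-nonZero⁻¹ m

    dual≢0 : dual m n a ≢ 0
    dual≢0 dual≡0 = <⇒≢ (proj₁ (∈-multipliers⁻ {m} a∈))
      (sym (dual-injectiveOn (proj₂ (∈-multipliers⁻ {m} a∈)) 0<m
         (trans dual≡0 (sym (m<n⇒m%n≡m 0<m)))))

  map-dual↭multipliers : map (dual m n) (multipliers m) ↭ multipliers m
  map-dual↭multipliers = Unique∧⊆∧length≡⇒↭
    (Unique-map⁺-injectiveOn
      (λ a∈ b∈ → dual-injectiveOn (proj₂ (∈-multipliers⁻ {m} a∈)) (proj₂ (∈-multipliers⁻ {m} b∈)))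
      (Unique-multipliers m))
    (λ b∈ → case ∈-map⁻ (dual m n) b∈ of λ { (a , a∈ , refl) → dual∈multipliers a∈ })
    (length-map (dual m n) (multipliers m))

totalBlocked≡totalStrided : ∀ m n .{{_ : NonZero m}} .{{_ : NonZero n}} → Coprime m n →
                            ∀ X → totalBlocked m n X ≡ totalStrided m n X
totalBlocked≡totalStrided m n m⊥n X = begin
  sum (map (λ a → maxload n (blockedBin m n a) X) M)  ≡⟨ cong sum (map-cong blocked≡strided∘dual M) ⟩
  sum (map (F ∘ dual m n) M)                          ≡⟨ cong sum (map-∘ M) ⟩
  sum (map F (map (dual m n) M))                      ≡⟨ sum-↭ (↭.map⁺ F (map-dual↭multipliers m⊥n)) ⟩
  sum (map F M)                                       ∎
  where
  open ≡-Reasoning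
  M : List ℕ
  M = multipliers m
  F : ℕ → ℕ
  F a = maxload n (stridedBin m n a) X
  blocked≡strided∘dual : ∀ a → maxload n (blockedBin m n a) X ≡ F (dual m n a)
  blocked≡strided∘dual a =
    maxload-cong (blocked-strided-kernel m n m⊥n a) (blockedBin<n m n a) (λ x → m%n<n _ n) X

mainTheorem7 : (m n : ℕ) .{{_ : NonZero m}} .{{_ : NonZero n}} → Coprime m n →
    (X : List ℕ) → Unique X → All (_< m) X → length X ≡ n →
    (totalStrided m n X ≤ 2 * totalBlocked m n X)
      × (totalBlocked m n X ≤ 2 * totalStrided m n X)
mainTheorem7 m n m⊥n X _ _ _ =
    ≤-trans (m≤n*m _ 2) (*-monoʳ-≤ 2 (≤-reflexive (sym blocked≡strided)))
  , ≤-trans (m≤n*m _ 2) (*-monoʳ-≤ 2 (≤-reflexive blocked≡strided))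
  where
  blocked≡strided : totalBlocked m n X ≡ totalStrided m n X
  blocked≡strided = totalBlocked≡totalStrided m n m⊥n X
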